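{- Let $I$ be a binary CSP instance and $x_i,x_j$ distinct variables. If $x_i$ justifies the elimination of $x_j$ by the triangle property in $I$, then $x_i$ justifies the elimination of $x_j$ by the triangle property in $\mathit{NS}(I)$.
   Context: A binary CSP instance $I=\langle X,\mathcal{D},R\rangle$ consists of a finite set $X$ of variables, a finite domain $\mathcal{D}(x_i)$ for each variable, and for each ordered pair of distinct variables $(x_i,x_j)$ a relation $R_{ij}\subseteq \mathcal{D}(x_i)\times\mathcal{D}(x_j)$, with $R_{ji}$ the transpose of $R_{ij}$. For distinct $x_i,x_j$, $x_i$ justifies the elimination by the triangle property of $x_j$ in an instance if for every $v_i\in\mathcal{D}(x_i)$ there exists $u\in\mathcal{D}(x_j)$ with $(u,v_i)\in R_{ji}$ and such that for all $x_k\in X\setminus\{x_i,x_j\}$ and all $v_k\in\mathcal{D}(x_k)$, $(v_i,v_k)\in R_{ik}$ implies $(u,v_k)\in R_{jk}$ (domains and relations of that instance). A value $v\in\mathcal{D}(x_q)$ is neighbourhood substitutable by $v'\in\mathcal{D}(x_q)\setminus\{v\}$ if for all $x_r\neq x_q$ and all $w\in\mathcal{D}(x_r)$, $(v,w)\in R_{qr}$ implies $(v',w)\in R_{qr}$. $\mathit{NS}(I)$ denotes the result of repeatedly deleting from $I$ values that are neighbourhood substitutable (by some other remaining value of the same domain) until no such value remains. -}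

module Defs where

open import Data.Nat using (ℕ)
open import Data.Fin using (Fin; _≟_)
open import Data.Bool using (Bool; true; false; if_then_else_; _∧_)
open import Data.Product using (Σ; ∃; _×_; _,_)
open import Relation.Nullary using (¬_)
open import Relation.Nullary.Decidable using (⌊_⌋)
open import Relation.Binary.PropositionalEquality using (_≡_; _≢_)
open import Relation.Binary.Construct.Closure.ReflexiveTransitive using (Star)

-- All domains are subsets of
-- a common finite value set Fin m:  value w is in D(x_r) iff dom r w ≡ true.
-- rel i j u v ≡ true  means  (u , v) ∈ R_ij.  R_ji is the transpose of R_ij
-- for distinct i, j  (R_ii is never used).
record CSP (n m : ℕ) : Set where
  field
    dom : Fin n → Fin m → Bool
    rel : Fin n → Fin n → Fin m → Fin m → Bool
    rel-transpose : ∀ i j → i ≢ j → ∀ u v → rel j i v u ≡ rel i j u v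
open CSP public

module _ {n m : ℕ} where

  _∈D_ : Fin m → (Fin m → Bool) → Set
  w ∈D d = d w ≡ true

  JustifiesTriangle : CSP n m → Fin n → Fin n → Set
  JustifiesTriangle I i j =
    ∀ vi → vi ∈D dom I i →
      Σ (Fin m) λ u → (u ∈D dom I j) × (rel I j i u vi ≡ true) ×
        (∀ k → k ≢ i → k ≢ j → ∀ vk → vk ∈D dom I k →
           rel I i k vi vk ≡ true → rel I j k u vk ≡ true)

  NSubBy : CSP n m → Fin n → Fin m → Fin m → Set
  NSubBy I q v v' =
    (v ∈D dom I q) × (v' ∈D dom I q) × (v' ≢ v) ×
    (∀ r → r ≢ q → ∀ w → w ∈D dom I r → rel I q r v w ≡ true → rel I q r v' w ≡ true)

  NSubstitutable : CSP n m → Fin n → Fin m → Set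
  NSubstitutable I q v = Σ (Fin m) λ v' → NSubBy I q v v'

  deleteValue : CSP n m → Fin n → Fin m → CSP n m
  deleteValue I q v = record
    { dom = λ r w → if ⌊ r ≟ q ⌋ ∧ ⌊ w ≟ v ⌋ then false else dom I r w
    ; rel = rel I
    ; rel-transpose = rel-transpose I
    }

  data NSStep (I : CSP n m) : CSP n m → Set where
    step : ∀ q v → NSubstitutable I q v → NSStep I (deleteValue I q v)

  NSReduces : CSP n m → CSP n m → Set
  NSReduces = Star NSStep

  NSIrreducible : CSP n m → Set
  NSIrreducible J = ∀ q v → ¬ NSubstitutable J q v

  -- J is a (possible) result NS(I): obtained by repeated deletion until none remains
  IsNS : CSP n m → CSP n m → Set
  IsNS I J = NSReduces I J × NSIrreducible J

{-# OPTIONS --safe #-}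
module Submission where

open import Defs
open import Data.Nat using (ℕ)
open import Data.Fin using (Fin; _≟_)
open import Data.Bool using (true)
open import Data.Sum using (_⊎_; inj₁; inj₂)
open import Data.Product using (Σ; _×_; _,_)
open import Relation.Nullary using (yes; no; contradiction)
open import Relation.Binary.PropositionalEquality using (_≡_; _≢_; refl)
open import Relation.Binary.Construct.Closure.ReflexiveTransitive using (ε; _◅_)

-- Deleting values only shrinks domains and leaves the relations untouched, so a
-- triangle witness u for vi survives a deletion unless u itself is the deleted
-- value of D(x_j).  In that case the value v' substituting u is again a witness:
-- it is compatible with everything u is compatible with, in particular with vi,
-- because x_i ≠ x_j.

module _ {n m : ℕ} where

  ∈D-deleteValue⁻ : ∀ (I : CSP n m) q v r w →
                    dom (deleteValue I q v) r w ≡ true → dom I r w ≡ true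
  ∈D-deleteValue⁻ I q v r w w∈ with r ≟ q | w ≟ v
  ... | yes _ | yes _ with () ← w∈
  ... | yes _ | no _  = w∈
  ... | no _  | _     = w∈

  ∈D-deleteValue⁺ : ∀ (I : CSP n m) q v r w → dom I r w ≡ true → (r ≡ q → w ≢ v) →
                    dom (deleteValue I q v) r w ≡ true
  ∈D-deleteValue⁺ I q v r w w∈ kept with r ≟ q | w ≟ v
  ... | yes r≡q | yes w≡v = contradiction w≡v (kept r≡q)
  ... | yes _   | no _    = w∈
  ... | no _    | _       = w∈

  TriangleWitness : CSP n m → Fin n → Fin n → Fin m → Fin m → Set
  TriangleWitness I i j vi u =
    (dom I j u ≡ true) × (rel I j i u vi ≡ true) ×
    (∀ k → k ≢ i → k ≢ j → ∀ vk → dom I k vk ≡ true →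
       rel I i k vi vk ≡ true → rel I j k u vk ≡ true)

  TriangleWitness-NSubBy : ∀ (I : CSP n m) {i j vi u u'} → i ≢ j → dom I i vi ≡ true →
                           NSubBy I j u u' →
                           TriangleWitness I i j vi u → TriangleWitness I i j vi u'
  TriangleWitness-NSubBy I i≢j vi∈ (_ , u'∈ , _ , u⊑u') (_ , rel-u-vi , support-u) =
    u'∈ , u⊑u' _ i≢j _ vi∈ rel-u-vi ,
    λ k k≢i k≢j vk vk∈ rel-vi-vk → u⊑u' k k≢j vk vk∈ (support-u k k≢i k≢j vk vk∈ rel-vi-vk)

  TriangleWitness-deleteValue : ∀ (I : CSP n m) {i j vi u} q v → (j ≡ q → u ≢ v) →
                                TriangleWitness I i j vi u →
                                TriangleWitness (deleteValue I q v) i j vi u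
  TriangleWitness-deleteValue I {j = j} {u = u} q v kept (u∈ , rel-u-vi , support-u) =
    ∈D-deleteValue⁺ I q v j u u∈ kept , rel-u-vi ,
    λ k k≢i k≢j vk vk∈ → support-u k k≢i k≢j vk (∈D-deleteValue⁻ I q v k vk vk∈)

  deleted-or-kept : ∀ (j q : Fin n) (u v : Fin m) → (j ≡ q × u ≡ v) ⊎ (j ≡ q → u ≢ v)
  deleted-or-kept j q u v with j ≟ q | u ≟ v
  ... | yes j≡q | yes u≡v = inj₁ (j≡q , u≡v)
  ... | yes _   | no u≢v  = inj₂ (λ _ → u≢v)
  ... | no j≢q  | _       = inj₂ (λ j≡q → contradiction j≡q j≢q)

  TriangleWitness-NSStep : ∀ (I : CSP n m) {i j vi u} → i ≢ j → dom I i vi ≡ true → ∀ q v →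
                           NSubstitutable I q v → TriangleWitness I i j vi u →
                           Σ (Fin m) (TriangleWitness (deleteValue I q v) i j vi)
  TriangleWitness-NSStep I {j = j} {u = u} i≢j vi∈ q v (v' , v⊑v'@(_ , _ , v'≢v , _)) witness
    with deleted-or-kept j q u v
  ... | inj₂ kept = u , TriangleWitness-deleteValue I q v kept witness
  ... | inj₁ (refl , refl) =
    v' , TriangleWitness-deleteValue I q v (λ _ → v'≢v)
           (TriangleWitness-NSubBy I i≢j vi∈ v⊑v' witness)

  JustifiesTriangle-NSStep : ∀ {I I′ : CSP n m} {i j} → i ≢ j → NSStep I I′ →
                             JustifiesTriangle I i j → JustifiesTriangle I′ i j
  JustifiesTriangle-NSStep {I} {i = i} i≢j (step q v substitutable) justifies vi vi∈′ =
    let vi∈ = ∈D-deleteValue⁻ I q v i vi vi∈′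
        _ , witness = justifies vi vi∈
    in TriangleWitness-NSStep I i≢j vi∈ q v substitutable witness

  JustifiesTriangle-NSReduces : ∀ {I J : CSP n m} {i j} → i ≢ j → NSReduces I J →
                                JustifiesTriangle I i j → JustifiesTriangle J i j
  JustifiesTriangle-NSReduces i≢j ε                  justifies = justifies
  JustifiesTriangle-NSReduces i≢j (firstStep ◅ rest) justifies =
    JustifiesTriangle-NSReduces i≢j rest (JustifiesTriangle-NSStep i≢j firstStep justifies)

lemma3 : ∀ {n m : ℕ} (I : CSP n m) (i j : Fin n) → i ≢ j →
           JustifiesTriangle I i j →
           ∀ (J : CSP n m) → IsNS I J → JustifiesTriangle J i j
lemma3 I i j i≢j justifies J (reduces , _) = JustifiesTriangle-NSReduces i≢j reduces justifies
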